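{- Let $n\ge 1$, let $B=(b_{ij})$ be a real $n\times n$ matrix with $b_{ij}\ge 0$ for all $i,j$ and $b_{ii}=0$, let $c\in\mathbb{R}^n$ and $X\subseteq\{0,1\}^n$. Let $\overline{X}$ satisfy $X\subseteq\overline{X}\subseteq[0,1]^n$, and for $i=1,\dots,n$ let $v_i=\max\{\sum_{j\neq i}b_{ij}x_j : x\in\overline{X},\ x_i=0\}$ and $l_i=\min\{\sum_{j\neq i}b_{ij}x_j : x\in\overline{X},\ x_i=1\}$. For $\lambda\in\{0,1\}^n$ put $\overline{\alpha}_i^{(\lambda)}=\sum_{j\neq i}\lambda_jb_{ji}+\lambda_i(v_i-l_i)$ and $\overline{\beta}^{(\lambda)}=\sum_{i=1}^n\lambda_iv_i$. Consider (PL$_2$): minimize $\sum_{i=1}^n (y_i+c_ix_i)$ over $(x,y)\in X\times\mathbb{R}^n$ subject to $y_i\ge\sum_{j\neq i}b_{ij}x_j+v_ix_i-v_i$ and $y_i\ge l_ix_i$ ($i=1,\dots,n$); (PL$_2'$): minimize $\sum_{i=1}^n (t_i+(l_i+c_i)x_i)$ over $(x,t)\in X\times\mathbb{R}^n$ subject to $t_i\ge\sum_{j\neq i}b_{ij}x_j+(v_i-l_i)x_i-v_i$ and $t_i\ge 0$ ($i=1,\dots,n$); (DL$_2$): minimize $z+\sum_{i=1}^n(l_i+c_i)x_i$ over $(z,x)\in\mathbb{R}\times X$ subject to $z\ge\sum_{i=1}^n\overline{\alpha}_i^{(\lambda)}x_i-\overline{\beta}^{(\lambda)}$ for every $\lambda\in\{0,1\}^n$.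 Then (PL$_2$) (and likewise (PL$_2'$)) and (DL$_2$) are equivalent in the sense that for each optimal solution to one problem, there exists an optimal solution to the other problem having the same optimal objective value.
   Context: $\overline{X}$ is a relaxation of $X$; it is assumed that for each $i$ the sets $\{x\in\overline{X}: x_i=0\}$ and $\{x\in\overline{X}: x_i=1\}$ are nonempty and the extrema defining $v_i,l_i$ are attained. -}

module Defs where

open import Data.Nat using (ℕ; zero; suc)
open import Data.Fin using (Fin; zero; suc; _≟_)
open import Data.Bool using (Bool; true; false; if_then_else_)
open import Data.Product using (_×_; _,_; ∃)
open import Data.Sum using (_⊎_)
open import Relation.Nullary.Decidable using (⌊_⌋)
open import Relation.Binary.PropositionalEquality using (_≡_)
open import Relation.Binary.Structures using (IsTotalOrder)
open import Algebra.Structures using (IsCommutativeRing)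

-- The real numbers ℝ are an instance; stdlib has no reals, so the theorem is
-- stated for every ordered commutative ring.
record OrderedCommRing : Set₁ where
  infixl 6 _+_ _-_
  infixl 7 _*_
  infix 4 _≤_
  field
    Carrier : Set
    _+_ _*_ : Carrier → Carrier → Carrier
    -_      : Carrier → Carrier
    0# 1#   : Carrier
    _≤_     : Carrier → Carrier → Set
    isCommutativeRing : IsCommutativeRing _≡_ _+_ _*_ -_ 0# 1#
    isTotalOrder      : IsTotalOrder _≡_ _≤_
    +-mono-≤          : ∀ {a b} c → a ≤ b → a + c ≤ b + c
    *-nonneg          : ∀ {a b} → 0# ≤ a → 0# ≤ b → 0# ≤ a * b

  _-_ : Carrier → Carrier → Carrier
  a - b = a + (- b)

module Problems (R : OrderedCommRing) where
  open OrderedCommRing R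

  ∑ : ∀ {n} → (Fin n → Carrier) → Carrier
  ∑ {zero}  f = 0#
  ∑ {suc n} f = f zero + ∑ (λ i → f (suc i))

  ∑≠ : ∀ {n} → Fin n → (Fin n → Carrier) → Carrier
  ∑≠ i f = ∑ (λ j → if ⌊ j ≟ i ⌋ then 0# else f j)

  ⟦_⟧ : Bool → Carrier
  ⟦ true ⟧  = 1#
  ⟦ false ⟧ = 0#

  Vec : ℕ → Set
  Vec n = Fin n → Carrier

  Mat : ℕ → Set
  Mat n = Fin n → Fin n → Carrier

  rowSum : ∀ {n} → Mat n → Vec n → Fin n → Carrier
  rowSum B x i = ∑≠ i (λ j → B i j * x j)

  IsMaxV : ∀ {n} → Mat n → (Vec n → Set) → Fin n → Carrier → Set
  IsMaxV B Xb i vi =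
    (∃ λ (x : Vec _) → Xb x × x i ≡ 0# × rowSum B x i ≡ vi)
    × (∀ x → Xb x → x i ≡ 0# → rowSum B x i ≤ vi)

  IsMinL : ∀ {n} → Mat n → (Vec n → Set) → Fin n → Carrier → Set
  IsMinL B Xb i li =
    (∃ λ (x : Vec _) → Xb x × x i ≡ 1# × rowSum B x i ≡ li)
    × (∀ x → Xb x → x i ≡ 1# → li ≤ rowSum B x i)

  αbar : ∀ {n} → Mat n → Vec n → Vec n → (Fin n → Bool) → Fin n → Carrier
  αbar B v l lam i = ∑≠ i (λ j → ⟦ lam j ⟧ * B j i) + ⟦ lam i ⟧ * (v i - l i)

  βbar : ∀ {n} → Vec n → (Fin n → Bool) → Carrier
  βbar v lam = ∑ (λ i → ⟦ lam i ⟧ * v i)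

  IsOptimal : {S : Set} → (S → Set) → (S → Carrier) → S → Set
  IsOptimal feas obj s = feas s × (∀ s' → feas s' → obj s ≤ obj s')

  module _ {n : ℕ} (B : Mat n) (c : Vec n) (X : Vec n → Set) (v l : Vec n) where

    PL2-feas : Vec n × Vec n → Set
    PL2-feas (x , y) = X x ×
      (∀ i → (rowSum B x i + v i * x i - v i ≤ y i) × (l i * x i ≤ y i))

    PL2-obj : Vec n × Vec n → Carrier
    PL2-obj (x , y) = ∑ (λ i → y i + c i * x i)

    PL2'-feas : Vec n × Vec n → Set
    PL2'-feas (x , t) = X x ×
      (∀ i → (rowSum B x i + (v i - l i) * x i - v i ≤ t i) × (0# ≤ t i))

    PL2'-obj : Vec n × Vec n → Carrier
    PL2'-obj (x , t) = ∑ (λ i → t i + (l i + c i) * x i)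

    DL2-feas : Carrier × Vec n → Set
    DL2-feas (z , x) = X x ×
      (∀ (lam : Fin n → Bool) → ∑ (λ i → αbar B v l lam i * x i) - βbar v lam ≤ z)

    DL2-obj : Carrier × Vec n → Carrier
    DL2-obj (z , x) = z + ∑ (λ i → (l i + c i) * x i)

module Submission where

-- All three problems range over the same x ∈ X, and the relationship between
-- them is purely algebraic.  Write  s_j(x) = ∑_{i≠j} b_ji x_i + (v_j − l_j) x_j − v_j
-- for the left-hand side of the first constraint of (PL₂').  Then
--   * (PL₂) and (PL₂') differ by the change of variables  t_i = y_i − l_i x_i ;
--   * the (DL₂) cut for λ ∈ {0,1}ⁿ is exactly  ∑_j λ_j s_j(x) ≤ z  (the identity
--     `cut-as-slack`, proved by exchanging the order of a double sum), so
--     z = ∑ t_j is (DL₂)-feasible, and conversely t_j = max(s_j(x), 0) is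
--     (PL₂')-feasible with ∑ t_j equal to the cut for λ_j = [s_j(x) ≥ 0].
-- Each direction is packaged as a "reduction": a map of feasible points that does
-- not increase the objective.  Mutual reductions transfer optimal solutions with
-- equal values (`optimum-transfer`), which yields the theorem.

open import Defs
open import Data.Nat using (ℕ; zero; suc) renaming (_≤_ to _≤ℕ_)
open import Data.Fin using (Fin; zero; suc; _≟_)
open import Data.Bool using (Bool; true; false; if_then_else_)
open import Data.Product using (∃; Σ; _×_; _,_; proj₁; proj₂)
open import Data.Sum using (_⊎_; inj₁; inj₂)
open import Data.Maybe using (nothing)
open import Data.Empty using (⊥-elim)
open import Relation.Nullary using (yes; no)
open import Relation.Nullary.Decidable using (⌊_⌋)
open import Relation.Binary.PropositionalEquality
  using (_≡_; refl; sym; trans; cong; cong₂; subst; subst₂; module ≡-Reasoning)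
open import Algebra.Bundles using (CommutativeRing)
open import Algebra.Structures using (IsCommutativeRing)
open import Relation.Binary.Structures using (IsTotalOrder)
open import Tactic.RingSolver.Core.AlmostCommutativeRing using (fromCommutativeRing)
import Tactic.RingSolver.NonReflective as RingSolver
import Algebra.Properties.Ring as RingProperties

module Development (R : OrderedCommRing) where
  open OrderedCommRing R
  open Problems R
  private
    module CR = IsCommutativeRing isCommutativeRing
    module TO = IsTotalOrder isTotalOrder
    commutativeRing : CommutativeRing _ _
    commutativeRing = record { isCommutativeRing = isCommutativeRing }
  -- The solver normalises with the abstract ring as coefficient ring, so it is
  -- used only for additive rearrangements; products are distributed by hand.
  open RingSolver (fromCommutativeRing commutativeRing (λ _ → nothing))
    using (solve; _⊜_; _⊕_; ⊝_)
  open RingProperties (CommutativeRing.ring commutativeRing)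
    using (-0#≈0#; x[y-z]≈xy-xz; [y-z]x≈yx-zx)

  -- Addition is monotone in both arguments (the axiom gives only the left one).
  +-mono₂ : ∀ {a b c d} → a ≤ b → c ≤ d → a + c ≤ b + d
  +-mono₂ {a} {b} {c} {d} a≤b c≤d = TO.trans (+-mono-≤ c a≤b) b+c≤b+d
    where
    b+c≤b+d : b + c ≤ b + d
    b+c≤b+d = subst₂ _≤_ (CR.+-comm c b) (CR.+-comm d b) (+-mono-≤ b c≤d)

  -- Adding −p + p changes nothing; used to finish additive rearrangements,
  -- since the solver cannot cancel p against −p.
  +-cancel-neg : ∀ a p → a + (- p + p) ≡ a
  +-cancel-neg a p = trans (cong (a +_) (CR.-‿inverseˡ p)) (CR.+-identityʳ a)

  ∑-cong : ∀ {m} {f g : Fin m → Carrier} → (∀ i → f i ≡ g i) → ∑ f ≡ ∑ g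
  ∑-cong {zero}  e = refl
  ∑-cong {suc m} e = cong₂ _+_ (e zero) (∑-cong (λ i → e (suc i)))

  ∑-mono : ∀ {m} {f g : Fin m → Carrier} → (∀ i → f i ≤ g i) → ∑ f ≤ ∑ g
  ∑-mono {zero}  e = TO.refl
  ∑-mono {suc m} e = +-mono₂ (e zero) (∑-mono (λ i → e (suc i)))

  ∑-zero : ∀ {m} → ∑ {m} (λ _ → 0#) ≡ 0#
  ∑-zero {zero}  = refl
  ∑-zero {suc m} = trans (cong (0# +_) (∑-zero {m})) (CR.+-identityˡ 0#)

  ∑-+ : ∀ {m} (f g : Fin m → Carrier) → ∑ (λ i → f i + g i) ≡ ∑ f + ∑ g
  ∑-+ {zero}  f g = sym (CR.+-identityˡ 0#)
  ∑-+ {suc m} f g =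
    trans (cong (f zero + g zero +_) (∑-+ (λ i → f (suc i)) (λ i → g (suc i))))
          (interchange (f zero) (g zero) _ _)
    where
    interchange : ∀ a b c d → (a + b) + (c + d) ≡ (a + c) + (b + d)
    interchange = solve 4 (λ a b c d → ((a ⊕ b) ⊕ (c ⊕ d)) ⊜ ((a ⊕ c) ⊕ (b ⊕ d))) refl

  ∑-neg : ∀ {m} (f : Fin m → Carrier) → ∑ (λ i → - f i) ≡ - ∑ f
  ∑-neg {zero}  f = sym -0#≈0#
  ∑-neg {suc m} f =
    trans (cong (- f zero +_) (∑-neg (λ i → f (suc i))))
          (neg-+ (f zero) (∑ (λ i → f (suc i))))
    where
    neg-+ : ∀ a b → - a + - b ≡ - (a + b)
    neg-+ = solve 2 (λ a b → (⊝ a ⊕ ⊝ b) ⊜ ⊝ (a ⊕ b)) refl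

  ∑-combine : ∀ {m} (f g h : Fin m → Carrier) →
    ∑ (λ j → f j + g j - h j) ≡ ∑ f + ∑ g - ∑ h
  ∑-combine f g h =
    trans (∑-+ (λ j → f j + g j) (λ j → - h j)) (cong₂ _+_ (∑-+ f g) (∑-neg h))

  ∑-*ˡ : ∀ {m} (a : Carrier) (f : Fin m → Carrier) → a * ∑ f ≡ ∑ (λ i → a * f i)
  ∑-*ˡ {zero}  a f = CR.zeroʳ a
  ∑-*ˡ {suc m} a f =
    trans (CR.distribˡ a (f zero) _) (cong (a * f zero +_) (∑-*ˡ a (λ i → f (suc i))))

  ∑-*ʳ : ∀ {m} (f : Fin m → Carrier) (a : Carrier) → ∑ f * a ≡ ∑ (λ i → f i * a)
  ∑-*ʳ f a = trans (CR.*-comm (∑ f) a)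
                   (trans (∑-*ˡ a f) (∑-cong (λ i → CR.*-comm a (f i))))

  ∑-swap : ∀ {m k} (F : Fin m → Fin k → Carrier) →
    ∑ (λ i → ∑ (λ j → F i j)) ≡ ∑ (λ j → ∑ (λ i → F i j))
  ∑-swap {zero}  {k} F = sym (∑-zero {k})
  ∑-swap {suc m}     F =
    trans (cong (∑ (F zero) +_) (∑-swap (λ i → F (suc i))))
          (sym (∑-+ (F zero) (λ j → ∑ (λ i → F (suc i) j))))

  if-zero-* : ∀ (b : Bool) (p a : Carrier) →
    (if b then 0# else p) * a ≡ (if b then 0# else p * a)
  if-zero-* true  p a = CR.zeroˡ a
  if-zero-* false p a = refl

  *-if-zero : ∀ (b : Bool) (a p : Carrier) →
    a * (if b then 0# else p) ≡ (if b then 0# else a * p)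
  *-if-zero true  a p = CR.zeroʳ a
  *-if-zero false a p = refl

  ∑≠-*ʳ : ∀ {m} (i : Fin m) (f : Fin m → Carrier) (a : Carrier) →
    ∑≠ i f * a ≡ ∑≠ i (λ j → f j * a)
  ∑≠-*ʳ i f a = trans (∑-*ʳ (λ j → if ⌊ j ≟ i ⌋ then 0# else f j) a)
                      (∑-cong (λ j → if-zero-* ⌊ j ≟ i ⌋ (f j) a))

  ∑≠-*ˡ : ∀ {m} (i : Fin m) (a : Carrier) (f : Fin m → Carrier) →
    a * ∑≠ i f ≡ ∑≠ i (λ j → a * f j)
  ∑≠-*ˡ i a f = trans (∑-*ˡ a (λ j → if ⌊ j ≟ i ⌋ then 0# else f j))
                      (∑-cong (λ j → *-if-zero ⌊ j ≟ i ⌋ a (f j)))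

  ≟-sym : ∀ {m} (i j : Fin m) → ⌊ i ≟ j ⌋ ≡ ⌊ j ≟ i ⌋
  ≟-sym i j with i ≟ j | j ≟ i
  ... | yes _   | yes _   = refl
  ... | no _    | no _    = refl
  ... | yes i≡j | no j≢i  = ⊥-elim (j≢i (sym i≡j))
  ... | no i≢j  | yes j≡i = ⊥-elim (i≢j (sym j≡i))

  ∑≠-transpose : ∀ {m} (F : Fin m → Fin m → Carrier) →
    ∑ (λ i → ∑≠ i (λ j → F j i)) ≡ ∑ (λ j → ∑≠ j (λ i → F j i))
  ∑≠-transpose F =
    trans (∑-swap (λ i j → if ⌊ j ≟ i ⌋ then 0# else F j i))
          (∑-cong (λ j → ∑-cong (λ i →
             cong (λ b → if b then 0# else F j i) (≟-sym j i))))

  Reduces : {S T : Set} → (S → Set) → (S → Carrier) → (T → Set) → (T → Carrier) → Set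
  Reduces {T = T} feasS objS feasT objT =
    ∀ s → feasS s → Σ T λ t → feasT t × objT t ≤ objS s

  reduces-trans : {S T U : Set} {fS : S → Set} {oS : S → Carrier}
    {fT : T → Set} {oT : T → Carrier} {fU : U → Set} {oU : U → Carrier} →
    Reduces fS oS fT oT → Reduces fT oT fU oU → Reduces fS oS fU oU
  reduces-trans S⇒T T⇒U s fs with S⇒T s fs
  ... | t , ft , t≤s with T⇒U t ft
  ... | u , fu , u≤t = u , fu , TO.trans u≤t t≤s

  optimum-transfer : {S T : Set} {fS : S → Set} {oS : S → Carrier}
    {fT : T → Set} {oT : T → Carrier} →
    Reduces fS oS fT oT → Reduces fT oT fS oS →
    ∀ s → IsOptimal fS oS s → ∃ λ t → IsOptimal fT oT t × oT t ≡ oS s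
  optimum-transfer {oS = oS} {fT = fT} {oT = oT} S⇒T T⇒S s (fs , s-min) with S⇒T s fs
  ... | t , ft , t≤s = t , (ft , t-min) , TO.antisym t≤s (s≤image t ft)
    where
    s≤image : ∀ t' → fT t' → oS s ≤ oT t'
    s≤image t' ft' with T⇒S t' ft'
    ... | s' , fs' , s'≤t' = TO.trans (s-min s' fs') s'≤t'
    t-min : ∀ t' → fT t' → oT t ≤ oT t'
    t-min t' ft' = TO.trans t≤s (s≤image t' ft')

  indicator-≤ : ∀ (b : Bool) {a t} → a ≤ t → 0# ≤ t → ⟦ b ⟧ * a ≤ t
  indicator-≤ true  {a} a≤t _   = subst (_≤ _) (sym (CR.*-identityˡ a)) a≤t
  indicator-≤ false {a} _   0≤t = subst (_≤ _) (sym (CR.zeroˡ a)) 0≤t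

  record PositivePart (a : Carrier) : Set where
    field
      value     : Carrier
      indicator : Bool
      above     : a ≤ value
      nonneg    : 0# ≤ value
      as-indicator : ⟦ indicator ⟧ * a ≡ value

  positivePart : ∀ a → PositivePart a
  positivePart a with TO.total 0# a
  ... | inj₁ 0≤a = record { value = a ; indicator = true ; above = TO.refl
                          ; nonneg = 0≤a ; as-indicator = CR.*-identityˡ a }
  ... | inj₂ a≤0 = record { value = 0# ; indicator = false ; above = a≤0
                          ; nonneg = TO.refl ; as-indicator = CR.zeroˡ a }

  -- The change of variables t = y − l·e between (PL₂) and (PL₂'), at the level
  -- of one row constraint (r = row sum, b = v_i, d = l_i, e = x_i) and of one
  -- objective term (p = l_i x_i, q = c_i x_i).
  shift-row : ∀ r b d e → r + b * e - b - d * e ≡ r + (b - d) * e - b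
  shift-row r b d e =
    trans (regroup r (b * e) (d * e) b)
          (cong (λ u → r + u - b) (sym ([y-z]x≈yx-zx e b d)))
    where
    regroup : ∀ r p q b → r + p - b - q ≡ r + (p - q) - b
    regroup = solve 4 (λ r p q b →
      (r ⊕ p ⊕ ⊝ b ⊕ ⊝ q) ⊜ (r ⊕ (p ⊕ ⊝ q) ⊕ ⊝ b)) refl

  unshift-row : ∀ r b d e → r + (b - d) * e - b + d * e ≡ r + b * e - b
  unshift-row r b d e = begin
    r + (b - d) * e - b + d * e          ≡⟨ cong (_+ d * e) (sym (shift-row r b d e)) ⟩
    r + b * e - b - d * e + d * e        ≡⟨ CR.+-assoc (r + b * e - b) (- (d * e)) (d * e) ⟩
    r + b * e - b + (- (d * e) + d * e)  ≡⟨ +-cancel-neg (r + b * e - b) (d * e) ⟩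
    r + b * e - b                        ∎
    where open ≡-Reasoning

  shift-objective : ∀ y p q → y - p + (p + q) ≡ y + q
  shift-objective y p q = trans (regroup y p q) (+-cancel-neg (y + q) p)
    where
    regroup : ∀ y p q → y - p + (p + q) ≡ (y + q) + (- p + p)
    regroup = solve 3 (λ y p q → (y ⊕ ⊝ p ⊕ (p ⊕ q)) ⊜ ((y ⊕ q) ⊕ (⊝ p ⊕ p))) refl

  module _ {n : ℕ} (B : Mat n) (c : Vec n) (X : Vec n → Set) (v l : Vec n) where

    slack : Vec n → Fin n → Carrier
    slack x j = rowSum B x j + (v j - l j) * x j - v j

    cut-as-slack : ∀ (lam : Fin n → Bool) (x : Vec n) →
      ∑ (λ i → αbar B v l lam i * x i) - βbar v lam ≡ ∑ (λ j → ⟦ lam j ⟧ * slack x j)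
    cut-as-slack lam x = begin
      ∑ (λ i → αbar B v l lam i * x i) - βbar v lam
        ≡⟨ cong (_- βbar v lam) (trans (∑-cong (λ i → CR.distribʳ (x i) _ _)) (∑-+ _ D)) ⟩
      ∑ (λ i → ∑≠ i (λ j → Λ j * B j i) * x i) + ∑ D - βbar v lam
        ≡⟨ cong (λ u → u + ∑ D - βbar v lam) cross-terms ⟩
      ∑ (λ j → Λ j * rowSum B x j) + ∑ D - βbar v lam
        ≡⟨ sym (∑-combine (λ j → Λ j * rowSum B x j) D (λ j → Λ j * v j)) ⟩
      ∑ (λ j → Λ j * rowSum B x j + D j - Λ j * v j)
        ≡⟨ ∑-cong (λ j → weighted-slack (Λ j) (rowSum B x j) (v j) (l j) (x j)) ⟩
      ∑ (λ j → Λ j * slack x j) ∎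
      where
      open ≡-Reasoning
      Λ D : Fin n → Carrier
      Λ j = ⟦ lam j ⟧
      D i = Λ i * (v i - l i) * x i
      cross-terms : ∑ (λ i → ∑≠ i (λ j → Λ j * B j i) * x i) ≡ ∑ (λ j → Λ j * rowSum B x j)
      cross-terms = begin
        ∑ (λ i → ∑≠ i (λ j → Λ j * B j i) * x i)
          ≡⟨ ∑-cong (λ i → ∑≠-*ʳ i (λ j → Λ j * B j i) (x i)) ⟩
        ∑ (λ i → ∑≠ i (λ j → Λ j * B j i * x i))
          ≡⟨ ∑≠-transpose (λ j i → Λ j * B j i * x i) ⟩
        ∑ (λ j → ∑≠ j (λ i → Λ j * B j i * x i))
          ≡⟨ ∑-cong (λ j → trans (∑-cong (λ i → cong (if ⌊ i ≟ j ⌋ then 0# else_)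
                                                 (CR.*-assoc (Λ j) (B j i) (x i))))
                                 (sym (∑≠-*ˡ j (Λ j) (λ i → B j i * x i)))) ⟩
        ∑ (λ j → Λ j * rowSum B x j) ∎
      weighted-slack : ∀ a r b d e → a * r + a * (b - d) * e - a * b ≡ a * (r + (b - d) * e - b)
      weighted-slack a r b d e = sym (begin
        a * (r + (b - d) * e - b)        ≡⟨ x[y-z]≈xy-xz a _ b ⟩
        a * (r + (b - d) * e) - a * b    ≡⟨ cong (_- a * b) (CR.distribˡ a r _) ⟩
        a * r + a * ((b - d) * e) - a * b
          ≡⟨ cong (λ u → a * r + u - a * b) (sym (CR.*-assoc a (b - d) e)) ⟩
        a * r + a * (b - d) * e - a * b  ∎)

    PL2⇒PL2' : Reduces (PL2-feas B c X v l) (PL2-obj B c X v l)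
                       (PL2'-feas B c X v l) (PL2'-obj B c X v l)
    PL2⇒PL2' (x , y) (x∈X , cons) =
      (x , t) , (x∈X , λ i → slack≤t i , 0≤t i) , TO.reflexive (∑-cong same-obj)
      where
      t : Vec n
      t i = y i - l i * x i
      slack≤t : ∀ i → slack x i ≤ t i
      slack≤t i = subst (_≤ t i) (shift-row (rowSum B x i) (v i) (l i) (x i))
                        (+-mono-≤ (- (l i * x i)) (proj₁ (cons i)))
      0≤t : ∀ i → 0# ≤ t i
      0≤t i = subst (_≤ t i) (CR.-‿inverseʳ (l i * x i))
                    (+-mono-≤ (- (l i * x i)) (proj₂ (cons i)))
      same-obj : ∀ i → t i + (l i + c i) * x i ≡ y i + c i * x i
      same-obj i =
        trans (cong (t i +_) (CR.distribʳ (x i) (l i) (c i)))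
              (shift-objective (y i) (l i * x i) (c i * x i))

    PL2'⇒PL2 : Reduces (PL2'-feas B c X v l) (PL2'-obj B c X v l)
                       (PL2-feas B c X v l) (PL2-obj B c X v l)
    PL2'⇒PL2 (x , t) (x∈X , cons) =
      (x , y) , (x∈X , λ i → row≤y i , lx≤y i) , TO.reflexive (∑-cong same-obj)
      where
      y : Vec n
      y i = t i + l i * x i
      row≤y : ∀ i → rowSum B x i + v i * x i - v i ≤ y i
      row≤y i = subst (_≤ y i) (unshift-row (rowSum B x i) (v i) (l i) (x i))
                      (+-mono-≤ (l i * x i) (proj₁ (cons i)))
      lx≤y : ∀ i → l i * x i ≤ y i
      lx≤y i = subst (_≤ y i) (CR.+-identityˡ (l i * x i))
                     (+-mono-≤ (l i * x i) (proj₂ (cons i)))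
      same-obj : ∀ i → y i + c i * x i ≡ t i + (l i + c i) * x i
      same-obj i = trans (CR.+-assoc (t i) (l i * x i) (c i * x i))
                         (cong (t i +_) (sym (CR.distribʳ (x i) (l i) (c i))))

    -- (PL₂') → (DL₂):  z = ∑ t_j bounds every cut, since λ_j s_j(x) ≤ t_j.
    PL2'⇒DL2 : Reduces (PL2'-feas B c X v l) (PL2'-obj B c X v l)
                       (DL2-feas B c X v l) (DL2-obj B c X v l)
    PL2'⇒DL2 (x , t) (x∈X , cons) =
      (∑ t , x) , (x∈X , cut≤z) , TO.reflexive (sym (∑-+ t (λ i → (l i + c i) * x i)))
      where
      cut≤z : ∀ lam → ∑ (λ i → αbar B v l lam i * x i) - βbar v lam ≤ ∑ t
      cut≤z lam = subst (_≤ ∑ t) (sym (cut-as-slack lam x))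
        (∑-mono (λ j → indicator-≤ (lam j) (proj₁ (cons j)) (proj₂ (cons j))))

    -- (DL₂) → (PL₂'):  t_j = s_j(x)⁺; the cut for λ_j = [s_j(x) ≥ 0] gives ∑ t_j ≤ z.
    DL2⇒PL2' : Reduces (DL2-feas B c X v l) (DL2-obj B c X v l)
                       (PL2'-feas B c X v l) (PL2'-obj B c X v l)
    DL2⇒PL2' (z , x) (x∈X , cuts) =
      (x , t) , (x∈X , λ i → above (pos i) , nonneg (pos i)) ,
      subst (_≤ DL2-obj B c X v l (z , x)) (sym (∑-+ t (λ i → (l i + c i) * x i)))
            (+-mono-≤ (∑ (λ i → (l i + c i) * x i)) ∑t≤z)
      where
      open PositivePart
      pos : ∀ i → PositivePart (slack x i)
      pos i = positivePart (slack x i)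
      t : Vec n
      t i = value (pos i)
      ∑t≤z : ∑ t ≤ z
      ∑t≤z = subst (_≤ z)
        (trans (cut-as-slack (λ i → indicator (pos i)) x) (∑-cong (λ i → as-indicator (pos i))))
        (cuts (λ i → indicator (pos i)))

theorem5 : (R : OrderedCommRing) → (n : ℕ) → 1 ≤ℕ n →
    let open OrderedCommRing R in let open Problems R in
    (B : Mat n) → (∀ i j → 0# ≤ B i j) → (∀ i → B i i ≡ 0#) →
    (c : Vec n) →
    (X : Vec n → Set) → (∀ x → X x → ∀ i → (x i ≡ 0#) ⊎ (x i ≡ 1#)) →
    (Xbar : Vec n → Set) → (∀ x → X x → Xbar x) →
    (∀ x → Xbar x → ∀ i → (0# ≤ x i) × (x i ≤ 1#)) →
    (v l : Vec n) → (∀ i → IsMaxV B Xbar i (v i)) → (∀ i → IsMinL B Xbar i (l i)) →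
    (∀ s → IsOptimal (PL2-feas B c X v l) (PL2-obj B c X v l) s →
    ∃ λ (s' : Carrier × Vec n) → IsOptimal (DL2-feas B c X v l) (DL2-obj B c X v l) s'
    × DL2-obj B c X v l s' ≡ PL2-obj B c X v l s)
    × (∀ s → IsOptimal (DL2-feas B c X v l) (DL2-obj B c X v l) s →
    ∃ λ (s' : Vec n × Vec n) → IsOptimal (PL2-feas B c X v l) (PL2-obj B c X v l) s'
    × PL2-obj B c X v l s' ≡ DL2-obj B c X v l s)
    × (∀ s → IsOptimal (PL2'-feas B c X v l) (PL2'-obj B c X v l) s →
    ∃ λ (s' : Carrier × Vec n) → IsOptimal (DL2-feas B c X v l) (DL2-obj B c X v l) s'
    × DL2-obj B c X v l s' ≡ PL2'-obj B c X v l s)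
    × (∀ s → IsOptimal (DL2-feas B c X v l) (DL2-obj B c X v l) s →
    ∃ λ (s' : Vec n × Vec n) → IsOptimal (PL2'-feas B c X v l) (PL2'-obj B c X v l) s'
    × PL2'-obj B c X v l s' ≡ DL2-obj B c X v l s)
theorem5 R n _ B _ _ c X _ Xbar _ _ v l _ _ =
  optimum-transfer PL2⇒DL2 DL2⇒PL2 ,
  optimum-transfer DL2⇒PL2 PL2⇒DL2 ,
  optimum-transfer (PL2'⇒DL2 B c X v l) (DL2⇒PL2' B c X v l) ,
  optimum-transfer (DL2⇒PL2' B c X v l) (PL2'⇒DL2 B c X v l)
  where
  open Development R
  open Problems R
  PL2⇒DL2 : Reduces (PL2-feas B c X v l) (PL2-obj B c X v l)
                    (DL2-feas B c X v l) (DL2-obj B c X v l)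
  PL2⇒DL2 = reduces-trans (PL2⇒PL2' B c X v l) (PL2'⇒DL2 B c X v l)
  DL2⇒PL2 : Reduces (DL2-feas B c X v l) (DL2-obj B c X v l)
                    (PL2-feas B c X v l) (PL2-obj B c X v l)
  DL2⇒PL2 = reduces-trans (DL2⇒PL2' B c X v l) (PL2'⇒PL2 B c X v l)
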